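{- Let $D$ be a finite digraph and $\alpha=(\alpha_v)_{v\in V(D)}$ a family of mutually disjoint finite digraphs. If $D$ is kernel-perfect and each $\alpha_v$ has a semi-Grundy function, then the Cartesian product $\sigma(D,\alpha)$ has a semi-Grundy function.
   Context: All digraphs are finite. For a vertex $x$ of a digraph $D$, $\Gamma^+(x)$ denotes the set of out-neighbours of $x$. A function $s:V(D)\to\mathbb{N}$ (with $\mathbb{N}=\{0,1,2,\dots\}$) is a semi-Grundy function of $D$ if (1) whenever $s(x)=k$, every $y\in\Gamma^+(x)$ satisfies $s(y)\neq k$; and (2) whenever $s(x)=k$, $y\in\Gamma^+(x)$ and $s(y)>k$, there exists $z\in\Gamma^+(y)$ with $s(z)=k$. A set $I\subseteq V(D)$ is independent if no arc has both ends in $I$; a kernel of $D$ is an independent set $N$ such that every vertex not in $N$ has an arc to some vertex of $N$; $D$ is kernel-perfect if every induced subdigraph of $D$ has a kernel. Given a digraph $D$ and a family $\alpha=(\alpha_v)_{v\in V(D)}$ of mutually disjoint digraphs, the Cartesian product $\sigma(D,\alpha)$ is the digraph with vertex set $\bigcup_{v\in V(D)}V(\alpha_v)$ and arc set $\bigcup_{v\in V(D)}A(\alpha_v)\cup\{(x,y): x\in V(\alpha_u),\ y\in V(\alpha_v),\ (u,v)\in A(D)\}$. -}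

module Defs where

open import Data.Nat using (ℕ; _<_)
open import Data.Fin using (Fin)
open import Data.Bool using (Bool; true; false)
open import Data.Product using (Σ; ∃; _×_; _,_)
open import Data.Sum using (_⊎_)
open import Relation.Nullary using (¬_)
open import Relation.Binary.PropositionalEquality using (_≡_; _≢_)

-- A finite digraph: vertex set Fin size, arc (x , y) iff adj x y ≡ true.
-- Loops are allowed (no restriction is imposed).
record Digraph : Set where
  field
    size : ℕ
    adj  : Fin size → Fin size → Bool
open Digraph public

V : Digraph → Set
V D = Fin (size D)

Arc : (D : Digraph) → V D → V D → Set
Arc D x y = adj D x y ≡ true

IsSemiGrundyOn : (X : Set) → (X → X → Set) → (X → ℕ) → Set
IsSemiGrundyOn X A s =
  (∀ x y → A x y → s y ≢ s x) ×
  (∀ x y → A x y → s x < s y → ∃ λ z → A y z × s z ≡ s x)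

IsSemiGrundy : (D : Digraph) → (V D → ℕ) → Set
IsSemiGrundy D = IsSemiGrundyOn (V D) (Arc D)

HasSemiGrundy : Digraph → Set
HasSemiGrundy D = Σ (V D → ℕ) (IsSemiGrundy D)

Subset : Digraph → Set
Subset D = V D → Bool

Mem : (D : Digraph) → V D → Subset D → Set
Mem D x S = S x ≡ true

IsKernelOfInduced : (D : Digraph) → Subset D → Subset D → Set
IsKernelOfInduced D S N =
  (∀ x → Mem D x N → Mem D x S) ×
  (∀ x y → Mem D x N → Mem D y N → ¬ Arc D x y) ×
  (∀ x → Mem D x S → ¬ Mem D x N → ∃ λ y → Mem D y N × Arc D x y)

KernelPerfect : Digraph → Set
KernelPerfect D = ∀ (S : Subset D) → ∃ λ N → IsKernelOfInduced D S N

-- Cartesian product σ(D, α).  The family α is indexed by V(D); mutual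
-- disjointness is realised by taking the disjoint union Σ v, V(α v).
ProdV : (D : Digraph) → (V D → Digraph) → Set
ProdV D α = Σ (V D) (λ v → V (α v))

ProdArc : (D : Digraph) → (α : V D → Digraph) → ProdV D α → ProdV D α → Set
ProdArc D α (u , a) (v , b) =
  (Σ (u ≡ v) λ { _≡_.refl → Arc (α u) a b }) ⊎ Arc D u v

HasSemiGrundyProd : (D : Digraph) → (V D → Digraph) → Set
HasSemiGrundyProd D α =
  Σ (ProdV D α → ℕ) (IsSemiGrundyOn (ProdV D α) (ProdArc D α))

module Submission where

-- A semi-Grundy function can be built layer by layer:
-- if S is an independent "semikernel" of the region R (every arc leaving S
-- inside R can be answered by an arc back into S), then a semi-Grundy
-- function of R ∖ S, shifted up by one and extended by 0 on S, is a
-- semi-Grundy function of R (lemma `peel`, valid for any arc relation).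
--
-- For σ(D, α) we peel along thresholds t : V(D) → ℕ, the region being
-- Above t = {(v , a) : t v ≤ s_v(a)} where s_v is the given semi-Grundy
-- function of α_v.  In one round, let level v be the least value of s_v
-- above t v (on the active vertices, those where this exists) and let N be
-- a kernel of D induced on the active vertices (kernel-perfectness).  The
-- layer {(v , a) : v ∈ N, s_v(a) = level v} is a semikernel of Above t,
-- and removing it is the same as raising the thresholds of N past their
-- levels.  This strictly decreases a bounded measure, so well-founded
-- recursion from t = 0 yields a semi-Grundy function of the whole product.

open import Defs
open import Data.Nat using (ℕ; zero; suc; _+_; _∸_; _≤_; _<_; z≤n; s≤s; _≤?_; _≟_)
open import Data.Nat.Properties
open import Data.Nat.Induction using (<-wellFounded)
open import Data.Fin using (Fin)
open import Data.Fin.Properties using (any?)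
open import Data.Bool using (Bool; true; false; if_then_else_)
import Data.Bool.Properties as Bool
open import Data.Product using (∃; _×_; _,_; proj₁; proj₂)
open import Data.Sum using (_⊎_; inj₁; inj₂)
open import Data.Empty using (⊥-elim)
open import Function using (_on_)
open import Induction.WellFounded using (Acc; acc)
open import Relation.Nullary using (¬_; yes; no)
open import Relation.Nullary.Decidable using (_×-dec_)
open import Relation.Nullary.Negation using (¬∃⟶∀¬)
open import Relation.Unary using (Decidable)
open import Relation.Binary.Construct.On as On using ()
open import Relation.Binary.PropositionalEquality

data Least {n : ℕ} (P : Fin n → Set) (f : Fin n → ℕ) : Set where
  none : (∀ i → ¬ P i) → Least P f
  some : (i : Fin n) → P i → (∀ j → P j → f i ≤ f j) → Least P f

least : ∀ {n} {P : Fin n → Set} → Decidable P → (f : Fin n → ℕ) → Least P f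
least {zero} P? f = none (λ ())
least {suc n} {P} P? f with least (λ i → P? (Fin.suc i)) (λ i → f (Fin.suc i)) | P? Fin.zero
... | none ¬P   | no ¬p = none λ { Fin.zero → ¬p ; (Fin.suc i) → ¬P i }
... | none ¬P   | yes p = some Fin.zero p λ { Fin.zero _ → ≤-refl ; (Fin.suc j) pj → ⊥-elim (¬P j pj) }
... | some i pi min | no ¬p = some (Fin.suc i) pi λ { Fin.zero p → ⊥-elim (¬p p) ; (Fin.suc j) → min j }
... | some i pi min | yes p with f Fin.zero ≤? f (Fin.suc i)
...   | yes f0≤ = some Fin.zero p λ { Fin.zero _ → ≤-refl ; (Fin.suc j) pj → ≤-trans f0≤ (min j pj) }
...   | no  f0≰ = some (Fin.suc i) pi λ { Fin.zero _ → <⇒≤ (≰⇒> f0≰) ; (Fin.suc j) → min j }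

module _ {n : ℕ} {P : Fin n → Set} {f : Fin n → ℕ} where

  found : Least P f → Bool
  found (none _)     = false
  found (some _ _ _) = true

  -- The least value (0 when the subset is empty).
  minValue : Least P f → ℕ
  minValue (none _)     = 0
  minValue (some i _ _) = f i

  minValue-attained : (r : Least P f) → found r ≡ true → ∃ λ i → P i × f i ≡ minValue r
  minValue-attained (some i pi _) _ = i , pi , refl

  minValue-≤ : (r : Least P f) → ∀ j → P j → minValue r ≤ f j
  minValue-≤ (none ¬P)    j pj = ⊥-elim (¬P j pj)
  minValue-≤ (some _ _ min) j pj = min j pj

  found-if-inhabited : (r : Least P f) → ∀ j → P j → found r ≡ true
  found-if-inhabited (none ¬P)   j pj = ⊥-elim (¬P j pj)
  found-if-inhabited (some _ _ _) _ _  = refl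

sum : ∀ {n} → (Fin n → ℕ) → ℕ
sum {zero}  f = 0
sum {suc n} f = f Fin.zero + sum (λ i → f (Fin.suc i))

term≤sum : ∀ {n} (f : Fin n → ℕ) i → f i ≤ sum f
term≤sum f Fin.zero    = m≤m+n _ _
term≤sum f (Fin.suc i) = ≤-trans (term≤sum (λ j → f (Fin.suc j)) i) (m≤n+m _ (f Fin.zero))

sum-mono : ∀ {n} {f g : Fin n → ℕ} → (∀ i → f i ≤ g i) → sum f ≤ sum g
sum-mono {zero}  f≤g = z≤n
sum-mono {suc n} f≤g = +-mono-≤ (f≤g Fin.zero) (sum-mono (λ i → f≤g (Fin.suc i)))

sum-strict : ∀ {n} {f g : Fin n → ℕ} → (∀ i → f i ≤ g i) → ∀ k → f k < g k → sum f < sum g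
sum-strict f≤g Fin.zero    fk<gk = +-mono-<-≤ fk<gk (sum-mono (λ i → f≤g (Fin.suc i)))
sum-strict f≤g (Fin.suc k) fk<gk = +-mono-≤-< (f≤g Fin.zero) (sum-strict (λ i → f≤g (Fin.suc i)) k fk<gk)

module Peeling {X : Set} (A : X → X → Set) where

  IsSemiGrundyIn : (X → Set) → (X → ℕ) → Set
  IsSemiGrundyIn R g =
    (∀ x y → R x → R y → A x y → g y ≢ g x) ×
    (∀ x y → R x → R y → A x y → g x < g y → ∃ λ z → R z × A y z × g z ≡ g x)

  record IsSemikernelIn (R S : X → Set) : Set where
    field
      within      : ∀ x → S x → R x
      independent : ∀ x y → S x → S y → ¬ A x y
      absorbs     : ∀ x y → S x → R y → ¬ S y → A x y → ∃ λ z → S z × A y z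

  empty-semiGrundy : ∀ {R} → (∀ x → ¬ R x) → (g : X → ℕ) → IsSemiGrundyIn R g
  empty-semiGrundy ¬R g = (λ x _ Rx _ _ → ⊥-elim (¬R x Rx))
                        , (λ x _ Rx _ _ _ → ⊥-elim (¬R x Rx))

  module _ {S : X → Set} (S? : Decidable S) (g′ : X → ℕ) where

    layered : X → ℕ
    layered x with S? x
    ... | yes _ = 0
    ... | no  _ = suc (g′ x)

    layered-view : ∀ x → (S x × layered x ≡ 0) ⊎ (¬ S x × layered x ≡ suc (g′ x))
    layered-view x with S? x
    ... | yes Sx = inj₁ (Sx , refl)
    ... | no ¬Sx = inj₂ (¬Sx , refl)

  peel : ∀ {R S R′} (S? : Decidable S) → IsSemikernelIn R S →
         (∀ x → R′ x → R x × ¬ S x) → (∀ x → R x → ¬ S x → R′ x) →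
         ∀ {g′} → IsSemiGrundyIn R′ g′ → IsSemiGrundyIn R (layered S? g′)
  peel {R} {S} {R′} S? sk R′⊆R∖S R∖S⊆R′ {g′} (proper′ , answer′) = proper , answer
    where
      open IsSemikernelIn sk
      g : X → ℕ
      g = layered S? g′

      proper : ∀ x y → R x → R y → A x y → g y ≢ g x
      proper x y Rx Ry xy with layered-view S? g′ x | layered-view S? g′ y
      ... | inj₁ (Sx , _)  | inj₁ (Sy , _)  = λ _ → independent x y Sx Sy xy
      ... | inj₁ (_ , gx)  | inj₂ (_ , gy)  = λ gy≡gx → 0≢1+n (trans (sym gx) (trans (sym gy≡gx) gy))
      ... | inj₂ (_ , gx)  | inj₁ (_ , gy)  = λ gy≡gx → 0≢1+n (trans (sym gy) (trans gy≡gx gx))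
      ... | inj₂ (¬Sx , gx) | inj₂ (¬Sy , gy) = λ gy≡gx →
            proper′ x y (R∖S⊆R′ x Rx ¬Sx) (R∖S⊆R′ y Ry ¬Sy) xy
                    (suc-injective (trans (sym gy) (trans gy≡gx gx)))

      answer : ∀ x y → R x → R y → A x y → g x < g y → ∃ λ z → R z × A y z × g z ≡ g x
      answer x y Rx Ry xy gx<gy with layered-view S? g′ x | layered-view S? g′ y
      ... | inj₁ (Sx , _)  | inj₁ (Sy , _) = ⊥-elim (independent x y Sx Sy xy)
      ... | inj₁ (Sx , gx) | inj₂ (¬Sy , _) with absorbs x y Sx Ry ¬Sy xy
      ...   | z , Sz , yz with layered-view S? g′ z
      ...     | inj₁ (_ , gz)  = z , within z Sz , yz , trans gz (sym gx)
      ...     | inj₂ (¬Sz , _) = ⊥-elim (¬Sz Sz)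
      answer x y Rx Ry xy gx<gy | inj₂ (_ , gx) | inj₁ (_ , gy) =
        ⊥-elim (n≮0 (subst₂ _<_ gx gy gx<gy))
      answer x y Rx Ry xy gx<gy | inj₂ (¬Sx , gx) | inj₂ (¬Sy , gy)
        with answer′ x y (R∖S⊆R′ x Rx ¬Sx) (R∖S⊆R′ y Ry ¬Sy) xy (≤-pred (subst₂ _<_ gx gy gx<gy))
      ... | z , R′z , yz , g′z≡g′x with layered-view S? g′ z
      ...   | inj₁ (Sz , _)  = ⊥-elim (proj₂ (R′⊆R∖S z R′z) Sz)
      ...   | inj₂ (_ , gz)  = z , proj₁ (R′⊆R∖S z R′z) , yz , trans gz (trans (cong suc g′z≡g′x) (sym gx))

module ThresholdPeeling (D : Digraph) (α : V D → Digraph) (kp : KernelPerfect D)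
                        (s : ∀ v → V (α v) → ℕ) (s-sg : ∀ v → IsSemiGrundy (α v) (s v)) where

  open Peeling (ProdArc D α)

  Threshold : Set
  Threshold = V D → ℕ

  Above : Threshold → ProdV D α → Set
  Above t (v , a) = t v ≤ s v a

  ceiling : V D → ℕ
  ceiling v = sum (λ a → suc (s v a))

  s<ceiling : ∀ v a → s v a < ceiling v
  s<ceiling v a = term≤sum (λ b → suc (s v b)) a

  μ : Threshold → ℕ
  μ t = sum (λ v → ceiling v ∸ t v)

  module Round (t : Threshold) where

    lowest : ∀ v → Least (λ a → t v ≤ s v a) (s v)
    lowest v = least (λ a → t v ≤? s v a) (s v)

    active : Subset D
    active v = found (lowest v)

    level : V D → ℕ
    level v = minValue (lowest v)

    level-≥-threshold : ∀ v → Mem D v active → t v ≤ level v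
    level-≥-threshold v act with minValue-attained (lowest v) act
    ... | _ , t≤s , s≡level = subst (t v ≤_) s≡level t≤s

    level-<-ceiling : ∀ v → Mem D v active → level v < ceiling v
    level-<-ceiling v act with minValue-attained (lowest v) act
    ... | a , _ , s≡level = subst (_< ceiling v) s≡level (s<ceiling v a)

    N : Subset D
    N = proj₁ (kp active)

    N-active : ∀ v → Mem D v N → Mem D v active
    N-active = proj₁ (proj₂ (kp active))

    N-independent : ∀ u w → Mem D u N → Mem D w N → ¬ Arc D u w
    N-independent = proj₁ (proj₂ (proj₂ (kp active)))

    N-absorbing : ∀ v → Mem D v active → ¬ Mem D v N → ∃ λ w → Mem D w N × Arc D v w
    N-absorbing = proj₂ (proj₂ (proj₂ (kp active)))

    Layer : ProdV D α → Set
    Layer (v , a) = Mem D v N × s v a ≡ level v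

    layer? : Decidable Layer
    layer? (v , a) = (N v Bool.≟ true) ×-dec (s v a ≟ level v)

    next : Threshold
    next v = if N v then suc (level v) else t v

    layer-semikernel : IsSemikernelIn (Above t) Layer
    layer-semikernel = record { within = within ; independent = independent ; absorbs = absorbs }
      where
        within : ∀ x → Layer x → Above t x
        within (v , a) (Nv , s≡level) = subst (t v ≤_) (sym s≡level) (level-≥-threshold v (N-active v Nv))

        independent : ∀ x y → Layer x → Layer y → ¬ ProdArc D α x y
        independent (u , a) (.u , b) (_ , sa≡) (_ , sb≡) (inj₁ (refl , ab)) =
          proj₁ (s-sg u) a b ab (trans sb≡ (sym sa≡))
        independent (u , a) (w , b) (Nu , _) (Nw , _) (inj₂ uw) = N-independent u w Nu Nw uw

        -- Inside a fibre the semi-Grundy property of s_u answers the arc;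
        -- between fibres the kernel N does.
        absorbs : ∀ x y → Layer x → Above t y → ¬ Layer y → ProdArc D α x y →
                  ∃ λ z → Layer z × ProdArc D α y z
        absorbs (u , a) (.u , b) (Nu , sa≡) t≤sb _ (inj₁ (refl , ab))
          with proj₂ (s-sg u) a b ab sa<sb
          where
            sa<sb : s u a < s u b
            sa<sb = ≤∧≢⇒< (subst (_≤ s u b) (sym sa≡) (minValue-≤ (lowest u) b t≤sb))
                          (λ sa≡sb → proj₁ (s-sg u) a b ab (sym sa≡sb))
        ... | c , bc , sc≡sa = (u , c) , (Nu , trans sc≡sa sa≡) , inj₁ (refl , bc)
        absorbs (u , a) (w , b) (Nu , _) t≤sb _ (inj₂ uw) with N w Bool.≟ true
        ... | yes Nw = ⊥-elim (N-independent u w Nu Nw uw)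
        ... | no ¬Nw with N-absorbing w (found-if-inhabited (lowest w) b t≤sb) ¬Nw
        ...   | w′ , Nw′ , ww′ with minValue-attained (lowest w′) (N-active w′ Nw′)
        ...     | c , _ , sc≡ = (w′ , c) , (Nw′ , sc≡) , inj₂ ww′

    next-above⇒above∖layer : ∀ x → Above next x → Above t x × ¬ Layer x
    next-above⇒above∖layer (v , a) next≤s with N v in Nv≡
    ... | true  = ≤-trans (level-≥-threshold v (N-active v Nv≡)) (<⇒≤ next≤s)
                , λ (_ , s≡level) → <-irrefl (sym s≡level) next≤s
    ... | false = next≤s , λ { (() , _) }

    above∖layer⇒next-above : ∀ x → Above t x → ¬ Layer x → Above next x
    above∖layer⇒next-above (v , a) t≤s ¬layer with N v
    ... | true  = ≤∧≢⇒< (minValue-≤ (lowest v) a t≤s) (λ level≡s → ¬layer (refl , sym level≡s))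
    ... | false = t≤s

    next-≥ : ∀ v → t v ≤ next v
    next-≥ v with N v in Nv≡
    ... | true  = ≤-trans (level-≥-threshold v (N-active v Nv≡)) (n≤1+n _)
    ... | false = ≤-refl

    next-decreases : ∀ v → Mem D v N → μ next < μ t
    next-decreases v Nv = sum-strict (λ u → ∸-monoʳ-≤ (ceiling u) (next-≥ u)) v gap
      where
        gap : ceiling v ∸ next v < ceiling v ∸ t v
        gap rewrite Nv = ∸-monoʳ-< (s≤s (level-≥-threshold v (N-active v Nv)))
                                   (level-<-ceiling v (N-active v Nv))

    -- An active vertex forces N to be nonempty, so the round makes progress.
    progress : ∀ v → Mem D v active → μ next < μ t
    progress v act with N v Bool.≟ true
    ... | yes Nv = next-decreases v Nv
    ... | no ¬Nv with N-absorbing v act ¬Nv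
    ...   | w , Nw , _ = next-decreases w Nw

    inactive⇒empty : (∀ v → ¬ Mem D v active) → ∀ x → ¬ Above t x
    inactive⇒empty none-active (v , a) t≤s = none-active v (found-if-inhabited (lowest v) a t≤s)

  semiGrundyAbove : ∀ t → Acc (_<_ on μ) t → ∃ (IsSemiGrundyIn (Above t))
  semiGrundyAbove t (acc smaller) with any? (λ v → Round.active t v Bool.≟ true)
  ... | no  none-active =
        (λ _ → 0) , empty-semiGrundy (inactive⇒empty (¬∃⟶∀¬ none-active)) (λ _ → 0)
    where open Round t
  ... | yes (v , act) with semiGrundyAbove (Round.next t) (smaller (Round.progress t v act))
  ...   | g′ , sg′ =
        layered layer? g′ ,
        peel layer? layer-semikernel next-above⇒above∖layer above∖layer⇒next-above sg′
    where open Round t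

  whole-product : ∃ (IsSemiGrundyIn (Above (λ _ → 0))) → HasSemiGrundyProd D α
  whole-product (g , proper , answer) =
    g , (λ x y → proper x y z≤n z≤n)
      , λ x y xy gx<gy → let (z , _ , yz , gz≡gx) = answer x y z≤n z≤n xy gx<gy in z , yz , gz≡gx

theorem5 : (D : Digraph) (α : V D → Digraph) →
    KernelPerfect D → (∀ v → HasSemiGrundy (α v)) → HasSemiGrundyProd D α
theorem5 D α kp hasSG =
  whole-product (semiGrundyAbove (λ _ → 0) (On.wellFounded μ <-wellFounded (λ _ → 0)))
  where open ThresholdPeeling D α kp (λ v → proj₁ (hasSG v)) (λ v → proj₂ (hasSG v))
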